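{- For any tournament $T$, $\Delta(T)\le 2\,\mathrm{ctw}(T)$.
   Context: A tournament is a digraph with exactly one arc between each pair of distinct vertices. Given an ordering $\sigma = \langle v_1,\dots,v_n\rangle$ of $V(T)$, an arc $(v_i,v_j)$ is backward if $j<i$; $d_\sigma(v)$ is the number of backward arcs incident to $v$; $\Delta_\sigma(T)=\max_v d_\sigma(v)$; the degreewidth is $\Delta(T)=\min_\sigma\Delta_\sigma(T)$. For each prefix $\langle v_1,\dots,v_k\rangle$ of $\sigma$, its cut is the set of backward arcs with head in the prefix and tail outside it; the width of $\sigma$ is the maximum cut size over all prefixes; the cutwidth $\mathrm{ctw}(T)$ is the minimum width over all orderings $\sigma$. -}

module Defs where

open import Data.Nat using (ℕ; zero; suc; _+_; _*_; _≤_; _<_; _<ᵇ_; _⊔_)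
open import Data.Fin using (Fin; zero; suc; toℕ)
open import Data.Fin.Permutation using (Permutation′; _⟨$⟩ˡ_)
open import Data.Bool using (Bool; true; false; not; _∧_; if_then_else_)
open import Data.Product using (Σ; _×_; ∃)
open import Relation.Binary.PropositionalEquality using (_≡_; _≢_)

record Tournament (n : ℕ) : Set where
  field
    adj    : Fin n → Fin n → Bool
    irrefl : ∀ v → adj v v ≡ false
    tourn  : ∀ u v → u ≢ v → adj u v ≡ not (adj v u)
open Tournament public

count : ∀ {n} → (Fin n → Bool) → ℕ
count {zero}  f = 0
count {suc n} f = (if f zero then 1 else 0) + count (λ i → f (suc i))

sumF : ∀ {n} → (Fin n → ℕ) → ℕ
sumF {zero}  f = 0
sumF {suc n} f = f zero + sumF (λ i → f (suc i))

-- maximum of f over Fin n (0 if n = 0)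
maxF : ∀ {n} → (Fin n → ℕ) → ℕ
maxF {zero}  f = 0
maxF {suc n} f = f zero ⊔ maxF (λ i → f (suc i))

-- An ordering σ = ⟨v_1,…,v_n⟩ of V(T) is a permutation of Fin n;
-- σ ⟨$⟩ʳ i is the vertex at position i, and pos σ v = σ ⟨$⟩ˡ v its position.
Ordering : ℕ → Set
Ordering n = Permutation′ n

pos : ∀ {n} → Ordering n → Fin n → ℕ
pos σ v = toℕ (σ ⟨$⟩ˡ v)

backward : ∀ {n} → Tournament n → Ordering n → Fin n → Fin n → Bool
backward T σ u v = adj T u v ∧ (pos σ v <ᵇ pos σ u)

dσ : ∀ {n} → Tournament n → Ordering n → Fin n → ℕ
dσ T σ v = count (λ u → backward T σ u v) + count (λ u → backward T σ v u)

Δσ : ∀ {n} → Tournament n → Ordering n → ℕ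
Δσ T σ = maxF (dσ T σ)

-- size of the cut of the prefix of length k (k = 0,…,n): backward arcs (u,v)
-- with head v in the prefix (pos v < k) and tail u outside it (k ≤ pos u)
cutSize : ∀ {n} → Tournament n → Ordering n → ℕ → ℕ
cutSize T σ k =
  sumF (λ u → count (λ v → backward T σ u v ∧ (pos σ v <ᵇ k) ∧ not (pos σ u <ᵇ k)))

width : ∀ {n} → Tournament n → Ordering n → ℕ
width {n} T σ = maxF {suc n} (λ k → cutSize T σ (toℕ k))

IsDegreewidth : ∀ {n} → Tournament n → ℕ → Set
IsDegreewidth T d = (∃ λ σ → Δσ T σ ≡ d) × (∀ σ → d ≤ Δσ T σ)

IsCutwidth : ∀ {n} → Tournament n → ℕ → Set
IsCutwidth T c = (∃ λ σ → width T σ ≡ c) × (∀ σ → c ≤ width T σ)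

{-# OPTIONS --safe #-}
module Submission where

open import Defs
open import Data.Nat using (ℕ; zero; suc; _+_; _*_; _≤_; _<_; _<ᵇ_; z≤n; s≤s)
open import Data.Nat.Properties
open import Data.Fin using (Fin; zero; suc; toℕ; fromℕ<)
open import Data.Fin.Properties using (toℕ<n; toℕ-fromℕ<)
open import Data.Fin.Permutation using (_⟨$⟩ˡ_)
open import Data.Bool using (Bool; true; false; not; _∧_; if_then_else_) renaming (T to IsTrue)
open import Data.Bool.Properties using (T-∧)
open import Data.Unit using (tt)
open import Data.Product using (_,_; proj₂)
open import Function.Bundles using (Equivalence)
open import Relation.Binary.PropositionalEquality using (subst; cong)

-- An arc (u,v) that is backward at v, i.e. u comes after v, crosses the cut of
-- the prefix ending at v; an arc (v,w) that is backward at v crosses the cut of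
-- the prefix ending just before v. So the in- and out-parts of d_σ(v) are each
-- at most the width of σ, and choosing σ of minimum width gives
-- Δ(T) ≤ Δ_σ(T) ≤ 2 · ctw(T).

≥⇒≮ᵇ : ∀ {m n} → n ≤ m → IsTrue (not (m <ᵇ n))
≥⇒≮ᵇ z≤n     = tt
≥⇒≮ᵇ (s≤s p) = ≥⇒≮ᵇ p

∧-intro : ∀ {a b} → IsTrue a → IsTrue b → IsTrue (a ∧ b)
∧-intro p q = Equivalence.from T-∧ (p , q)

f≤sumF : ∀ {n} (f : Fin n → ℕ) (i : Fin n) → f i ≤ sumF f
f≤sumF f zero    = m≤m+n _ _
f≤sumF f (suc i) = ≤-trans (f≤sumF (λ j → f (suc j)) i) (m≤n+m _ _)

f≤maxF : ∀ {n} (f : Fin n → ℕ) (i : Fin n) → f i ≤ maxF f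
f≤maxF f zero    = m≤m⊔n _ _
f≤maxF f (suc i) = ≤-trans (f≤maxF (λ j → f (suc j)) i) (m≤n⊔m _ _)

maxF-lub : ∀ {n} (f : Fin n → ℕ) {b : ℕ} → (∀ i → f i ≤ b) → maxF f ≤ b
maxF-lub {zero}  f h = z≤n
maxF-lub {suc n} f h = ⊔-lub (h zero) (maxF-lub (λ j → f (suc j)) (λ j → h (suc j)))

count-pos : ∀ {n} (f : Fin n → Bool) {i : Fin n} → IsTrue (f i) → 1 ≤ count f
count-pos f {zero} t with f zero
... | true = s≤s z≤n
count-pos f {suc i} t = ≤-trans (count-pos (λ j → f (suc j)) t) (m≤n+m _ _)

count-mono : ∀ {n} (f g : Fin n → Bool) → (∀ i → IsTrue (f i) → IsTrue (g i)) →
             count f ≤ count g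
count-mono {zero}  f g h = z≤n
count-mono {suc n} f g h =
  +-mono-≤ head (count-mono (λ j → f (suc j)) (λ j → g (suc j)) (λ j → h (suc j)))
  where
    head : (if f zero then 1 else 0) ≤ (if g zero then 1 else 0)
    head with f zero | g zero | h zero
    ... | false | _     | _     = z≤n
    ... | true  | true  | _     = ≤-refl
    ... | true  | false | f⇒g   with () ← f⇒g tt

count≤sumF : ∀ {n} (f : Fin n → Bool) (g : Fin n → ℕ) → (∀ i → IsTrue (f i) → 1 ≤ g i) →
             count f ≤ sumF g
count≤sumF {zero}  f g h = z≤n
count≤sumF {suc n} f g h =
  +-mono-≤ head (count≤sumF (λ j → f (suc j)) (λ j → g (suc j)) (λ j → h (suc j)))
  where
    head : (if f zero then 1 else 0) ≤ g zero
    head with f zero | h zero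
    ... | false | _     = z≤n
    ... | true  | 1≤g   = 1≤g tt

module _ {n : ℕ} (T : Tournament n) (σ : Ordering n) where

  crossesCut : ℕ → Fin n → Fin n → Bool
  crossesCut k u v = backward T σ u v ∧ (pos σ v <ᵇ k) ∧ not (pos σ u <ᵇ k)

  backward-crosses : ∀ {u v k} → IsTrue (backward T σ u v) → pos σ v < k → k ≤ pos σ u →
                     IsTrue (crossesCut k u v)
  backward-crosses b v<k k≤u = ∧-intro b (∧-intro (<⇒<ᵇ v<k) (≥⇒≮ᵇ k≤u))

  pos-backward : ∀ {u v} → IsTrue (backward T σ u v) → pos σ v < pos σ u
  pos-backward {u} {v} b = <ᵇ⇒< (pos σ v) (pos σ u) (proj₂ (Equivalence.to T-∧ b))

  cut≤width : ∀ {k} → k ≤ n → cutSize T σ k ≤ width T σ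
  cut≤width k≤n = subst (λ k → cutSize T σ k ≤ width T σ) (toℕ-fromℕ< (s≤s k≤n))
                    (f≤maxF (λ k → cutSize T σ (toℕ k)) (fromℕ< (s≤s k≤n)))

  inDegree≤cut : ∀ v → count (λ u → backward T σ u v) ≤ cutSize T σ (suc (pos σ v))
  inDegree≤cut v = count≤sumF _ _ λ u b →
    count-pos (crossesCut (suc (pos σ v)) u) (backward-crosses b ≤-refl (pos-backward b))

  outDegree≤cut : ∀ v → count (λ w → backward T σ v w) ≤ cutSize T σ (pos σ v)
  outDegree≤cut v = ≤-trans
    (count-mono (backward T σ v) (crossesCut (pos σ v) v) λ w b →
       backward-crosses b (pos-backward b) ≤-refl)
    (f≤sumF (λ u → count (crossesCut (pos σ v) u)) v)

  dσ≤width+width : ∀ v → dσ T σ v ≤ width T σ + width T σ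
  dσ≤width+width v =
    +-mono-≤ (≤-trans (inDegree≤cut v) (cut≤width pos<n))
             (≤-trans (outDegree≤cut v) (cut≤width (<⇒≤ pos<n)))
    where
      pos<n : pos σ v < n
      pos<n = toℕ<n (σ ⟨$⟩ˡ v)

mainTheorem14 : ∀ (n : ℕ) (T : Tournament n) (d c : ℕ) →
                  IsDegreewidth T d → IsCutwidth T c → d ≤ 2 * c
mainTheorem14 n T d c (_ , d≤Δσ) ((σ , width≡c) , _) = begin
  d                      ≤⟨ d≤Δσ σ ⟩
  Δσ T σ                 ≤⟨ maxF-lub (dσ T σ) (dσ≤width+width T σ) ⟩
  width T σ + width T σ  ≡⟨ cong (λ w → w + w) width≡c ⟩
  c + c                  ≡⟨ cong (c +_) (+-identityʳ c) ⟨
  2 * c                  ∎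
  where open ≤-Reasoning
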